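{- Let $\preceq$ be an entrenchment relation and $\alpha,\beta\in\mathcal{L}$. Then: (1) if $\alpha\vdash\beta$ and $\beta\vdash\alpha$, then $\mathrm{Coh}(\alpha)=\mathrm{Coh}(\beta)=\mathrm{Coh}(\alpha\land\beta)$; (2) if $\preceq$ satisfies Bounded Cut, then $\neg\beta\preceq\neg\alpha$ implies $\mathrm{Coh}(\alpha)\subseteq\mathrm{Coh}(\alpha\land\beta)$ (and hence $\mathcal{B}(\alpha)\subseteq\mathcal{B}(\alpha\land\beta)$); (3) if $\preceq$ satisfies Bounded Right Monotonicity, then $\neg\beta\preceq\neg\alpha$ implies $\mathrm{Coh}(\alpha\land\beta)\subseteq\mathrm{Coh}(\alpha)$ (and hence $\mathcal{B}(\alpha\land\beta)\subseteq\mathcal{B}(\alpha)$); (4) if $\preceq$ satisfies Bounded Cut and Bounded Right Monotonicity, then $\neg\beta\preceq\neg\alpha$ implies $\mathrm{Coh}(\alpha\land\beta)=\mathrm{Coh}(\alpha)$ (and hence $\mathcal{B}(\alpha)=\mathcal{B}(\alpha\land\beta)$); (5) if $\preceq$ satisfies Right Monotonicity, then $\alpha\vdash\beta$ implies $\mathrm{Coh}(\alpha)\subseteq\mathrm{Coh}(\beta)$ (and hence $\mathcal{B}(\alpha)\subseteq\mathcal{B}(\beta)$).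
   Context: $\mathcal{L}$ is the set of formulas of a propositional language closed under $\lor,\land,\neg,\to$. $\vdash\subseteq 2^{\mathcal{L}}\times\mathcal{L}$ is a fixed consequence relation including classical propositional logic, compact, satisfying the deduction theorem and disjunction in premises; $\alpha\vdash\beta$ means $\{\alpha\}\vdash\beta$; $\mathrm{Cn}(X)=\{\beta:X\vdash\beta\}$. An entrenchment relation is a binary relation $\preceq$ on $\mathcal{L}$ such that for all $\alpha,\beta,\gamma$: $\alpha\preceq\alpha$; $\alpha\vdash\beta$ and $\beta\preceq\gamma$ imply $\alpha\preceq\gamma$; if $\alpha\vdash\beta$ and $\beta\vdash\alpha$ then $\gamma\preceq\alpha$ iff $\gamma\preceq\beta$. Properties (each for all $\alpha,\beta,\gamma$): Bounded Cut: $\gamma\preceq\alpha\lor\beta$ and $\beta\preceq\alpha$ imply $\gamma\preceq\alpha$. Bounded Right Monotonicity: $\gamma\preceq\alpha$ and $\beta\preceq\alpha$ imply $\gamma\preceq\alpha\lor\beta$. Right Monotonicity: $\alpha\preceq\beta$ and $\beta\vdash\gamma$ imply $\alpha\preceq\gamma$. $\mathrm{Coh}(\alpha)=\{\beta:\beta\not\preceq\neg\alpha\}$; $\mathcal{B}(\alpha)$ is the set of deductively closed $U$ ($U=\mathrm{Cn}(U)$) with $U\subseteq\mathrm{Coh}(\alpha)$. -}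

module Defs where

open import Level using (Level; 0ℓ) renaming (suc to lsuc)
open import Data.Bool using (Bool; true; false; _∧_; _∨_; not)
open import Data.Product using (_×_; _,_; Σ; ∃-syntax)
open import Data.List using (List)
open import Data.List.Membership.Propositional using (_∈_)
open import Data.List.Relation.Unary.All using (All)
open import Relation.Binary.PropositionalEquality using (_≡_)
open import Relation.Nullary using (¬_)
open import Relation.Unary using (Pred; _⊆_; _≐_; _∪_; ｛_｝) renaming (_∈_ to _∈ₚ_)
open import Function.Bundles using (_⇔_)

data Formula (At : Set) : Set where
  var  : At → Formula At
  _∨'_ : Formula At → Formula At → Formula At
  _∧'_ : Formula At → Formula At → Formula At
  ¬'_  : Formula At → Formula At
  _⇒'_ : Formula At → Formula At → Formula At

infixr 6 _∧'_
infixr 5 _∨'_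
infixr 4 _⇒'_
infix 7 ¬'_

module _ {At : Set} where

  eval : (At → Bool) → Formula At → Bool
  eval v (var a)  = v a
  eval v (φ ∨' ψ) = eval v φ ∨ eval v ψ
  eval v (φ ∧' ψ) = eval v φ ∧ eval v ψ
  eval v (¬' φ)   = not (eval v φ)
  eval v (φ ⇒' ψ) = not (eval v φ) ∨ eval v ψ

  _⊨_ : Pred (Formula At) 0ℓ → Formula At → Set
  X ⊨ φ = (v : At → Bool) → (∀ {ψ} → ψ ∈ₚ X → eval v ψ ≡ true) → eval v φ ≡ true

  listSet : List (Formula At) → Pred (Formula At) 0ℓ
  listSet xs = λ φ → φ ∈ xs

record ConsequenceRelation (At : Set) : Set₁ where
  field
    _⊢_ : Pred (Formula At) 0ℓ → Formula At → Set
    inclusion    : ∀ {X φ} → φ ∈ₚ X → X ⊢ φ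
    monotony     : ∀ {X Y φ} → X ⊆ Y → X ⊢ φ → Y ⊢ φ
    cut          : ∀ {X Y φ} → (∀ {ψ} → ψ ∈ₚ Y → X ⊢ ψ) → (X ∪ Y) ⊢ φ → X ⊢ φ
    supraclassical : ∀ {X φ} → X ⊨ φ → X ⊢ φ
    compact      : ∀ {X φ} → X ⊢ φ →
                   ∃[ xs ] (All (λ ψ → ψ ∈ₚ X) xs × listSet xs ⊢ φ)
    deduction    : ∀ {X φ ψ} → ((X ∪ ｛ φ ｝) ⊢ ψ) ⇔ (X ⊢ (φ ⇒' ψ))
    disjPremises : ∀ {X φ ψ χ} → (X ∪ ｛ φ ｝) ⊢ χ → (X ∪ ｛ ψ ｝) ⊢ χ →
                   (X ∪ ｛ φ ∨' ψ ｝) ⊢ χ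

module Entrenchment {At : Set} (C : ConsequenceRelation At) where
  open ConsequenceRelation C public

  _⊢₁_ : Formula At → Formula At → Set
  α ⊢₁ β = ｛ α ｝ ⊢ β

  Cn : Pred (Formula At) 0ℓ → Pred (Formula At) 0ℓ
  Cn X = λ β → X ⊢ β

  record IsEntrenchment (_≼_ : Formula At → Formula At → Set) : Set where
    field
      refl≼    : ∀ {α} → α ≼ α
      leftLog  : ∀ {α β γ} → α ⊢₁ β → β ≼ γ → α ≼ γ
      rightEq  : ∀ {α β γ} → α ⊢₁ β → β ⊢₁ α → (γ ≼ α ⇔ γ ≼ β)

  module _ (_≼_ : Formula At → Formula At → Set) where

    BoundedCut : Set
    BoundedCut = ∀ {α β γ} → γ ≼ (α ∨' β) → β ≼ α → γ ≼ α

    BoundedRightMonotonicity : Set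
    BoundedRightMonotonicity = ∀ {α β γ} → γ ≼ α → β ≼ α → γ ≼ (α ∨' β)

    RightMonotonicity : Set
    RightMonotonicity = ∀ {α β γ} → α ≼ β → β ⊢₁ γ → α ≼ γ

    Coh : Formula At → Pred (Formula At) 0ℓ
    Coh α = λ β → ¬ (β ≼ (¬' α))

    B : Formula At → Pred (Pred (Formula At) 0ℓ) 0ℓ
    B α = λ U → (U ≐ Cn U) × (U ⊆ Coh α)

  _⊆ᶠ_ : Pred (Pred (Formula At) 0ℓ) 0ℓ → Pred (Pred (Formula At) 0ℓ) 0ℓ → Set₁
  F ⊆ᶠ G = ∀ {U} → F U → G U

  _≐ᶠ_ : Pred (Pred (Formula At) 0ℓ) 0ℓ → Pred (Pred (Formula At) 0ℓ) 0ℓ → Set₁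
  F ≐ᶠ G = (F ⊆ᶠ G) × (G ⊆ᶠ F)

-- Coh α is the complement of the down-set of ¬α, so every claim compares ¬α, ¬β
-- and ¬(α ∧ β) in the entrenchment order.  Negation reverses ⊢, which with the
-- substitutivity of equivalents gives (1) and with Right Monotonicity gives (5).
-- Classically ¬(α ∧ β) is equivalent to ¬α ∨ ¬β, and given ¬β ≼ ¬α, Bounded Cut and
-- Bounded Right Monotonicity pass between ¬α ∨ ¬β and ¬α, giving (2)–(4).
module Submission where

open import Defs
open import Data.Bool using (true; false; not; _∧_; _∨_)
open import Data.Bool.Properties using (∨-∧-booleanAlgebra)
open import Algebra.Lattice.Properties.BooleanAlgebra ∨-∧-booleanAlgebra using (deMorgan₁)
open import Data.Product using (_×_; _,_)
open import Data.Sum using (inj₁; inj₂)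
open import Function.Bundles using (Equivalence; _⇔_)
open import Relation.Binary.PropositionalEquality using (_≡_; refl; subst; sym)
open import Relation.Unary using (_⊆_; _≐_; ｛_｝)

modus-tollens : ∀ a b → not a ≡ true → not b ∨ a ≡ true → not b ≡ true
modus-tollens false false _ _ = refl
modus-tollens false true  _ ()

∧-introᵇ : ∀ {a b} → a ≡ true → b ≡ true → a ∧ b ≡ true
∧-introᵇ refl refl = refl

∧-elimʳᵇ : ∀ a b → a ∧ b ≡ true → b ≡ true
∧-elimʳᵇ true _ eq = eq

module Classical {At : Set} (C : ConsequenceRelation At) where
  open Entrenchment C

  _⊨₁_ : Formula At → Formula At → Set
  α ⊨₁ β = ∀ v → eval v α ≡ true → eval v β ≡ true

  ⊨₁⇒⊢₁ : ∀ {α β} → α ⊨₁ β → α ⊢₁ β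
  ⊨₁⇒⊢₁ α⊨β = supraclassical λ v ⊨α → α⊨β v (⊨α refl)

  ⊢₁-cut : ∀ {γ ψ φ} → γ ⊢₁ ψ →
           (∀ v → eval v γ ≡ true → eval v ψ ≡ true → eval v φ ≡ true) → γ ⊢₁ φ
  ⊢₁-cut {ψ = ψ} γ⊢ψ γψ⊨φ =
    cut {Y = ｛ ψ ｝} (λ { refl → γ⊢ψ })
        (supraclassical λ v ⊨γψ → γψ⊨φ v (⊨γψ (inj₁ refl)) (⊨γψ (inj₂ refl)))

  ⊢₁-⇒ : ∀ {α β γ} → α ⊢₁ β → γ ⊢₁ (α ⇒' β)
  ⊢₁-⇒ α⊢β = Equivalence.to deduction (monotony inj₂ α⊢β)

  ¬-antitone : ∀ {α β} → α ⊢₁ β → (¬' β) ⊢₁ (¬' α)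
  ¬-antitone {α} {β} α⊢β = ⊢₁-cut (⊢₁-⇒ α⊢β) λ v → modus-tollens (eval v β) (eval v α)

  ∧-introʳ : ∀ {α β} → β ⊢₁ α → β ⊢₁ (α ∧' β)
  ∧-introʳ β⊢α = ⊢₁-cut β⊢α λ v ⊨β ⊨α → ∧-introᵇ ⊨α ⊨β

  ∧-elimʳ : ∀ {α β} → (α ∧' β) ⊢₁ β
  ∧-elimʳ {α} {β} = ⊨₁⇒⊢₁ λ v → ∧-elimʳᵇ (eval v α) (eval v β)

  ¬∧⊢¬∨¬ : ∀ {α β} → (¬' (α ∧' β)) ⊢₁ ((¬' α) ∨' (¬' β))
  ¬∧⊢¬∨¬ {α} {β} = ⊨₁⇒⊢₁ λ v → subst (_≡ true) (deMorgan₁ (eval v α) (eval v β))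

  ¬∨¬⊢¬∧ : ∀ {α β} → ((¬' α) ∨' (¬' β)) ⊢₁ (¬' (α ∧' β))
  ¬∨¬⊢¬∧ {α} {β} = ⊨₁⇒⊢₁ λ v → subst (_≡ true) (sym (deMorgan₁ (eval v α) (eval v β)))

module Coherence {At : Set} (C : ConsequenceRelation At)
                 (_≼_ : Formula At → Formula At → Set) where
  open Entrenchment C
  open Classical C

  B-mono : ∀ {α β} → Coh _≼_ α ⊆ Coh _≼_ β → B _≼_ α ⊆ᶠ B _≼_ β
  B-mono Cohα⊆Cohβ (closed , U⊆Cohα) = closed , λ u → Cohα⊆Cohβ (U⊆Cohα u)

  module _ (E : IsEntrenchment _≼_) where
    open IsEntrenchment E

    Coh-cong : ∀ {α β} → α ⊢₁ β → β ⊢₁ α → Coh _≼_ α ≐ Coh _≼_ β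
    Coh-cong {α} {β} α⊢β β⊢α =
        (λ γ∈Cohα γ≼¬β → γ∈Cohα (Equivalence.from ¬α⇔¬β γ≼¬β))
      , (λ γ∈Cohβ γ≼¬α → γ∈Cohβ (Equivalence.to ¬α⇔¬β γ≼¬α))
      where
      ¬α⇔¬β : ∀ {γ} → (γ ≼ (¬' α)) ⇔ (γ ≼ (¬' β))
      ¬α⇔¬β = rightEq (¬-antitone β⊢α) (¬-antitone α⊢β)

    ≼¬∧⇔≼¬∨¬ : ∀ {α β γ} → (γ ≼ (¬' (α ∧' β))) ⇔ (γ ≼ ((¬' α) ∨' (¬' β)))
    ≼¬∧⇔≼¬∨¬ = rightEq ¬∧⊢¬∨¬ ¬∨¬⊢¬∧

    Coh⊆Coh-∧ : BoundedCut _≼_ → ∀ {α β} → (¬' β) ≼ (¬' α) → Coh _≼_ α ⊆ Coh _≼_ (α ∧' β)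
    Coh⊆Coh-∧ bc ¬β≼¬α γ∈Cohα γ≼¬∧ = γ∈Cohα (bc (Equivalence.to ≼¬∧⇔≼¬∨¬ γ≼¬∧) ¬β≼¬α)

    Coh-∧⊆Coh : BoundedRightMonotonicity _≼_ → ∀ {α β} → (¬' β) ≼ (¬' α) →
                Coh _≼_ (α ∧' β) ⊆ Coh _≼_ α
    Coh-∧⊆Coh brm ¬β≼¬α γ∈Coh∧ γ≼¬α = γ∈Coh∧ (Equivalence.from ≼¬∧⇔≼¬∨¬ (brm γ≼¬α ¬β≼¬α))

  Coh-mono : RightMonotonicity _≼_ → ∀ {α β} → α ⊢₁ β → Coh _≼_ α ⊆ Coh _≼_ β
  Coh-mono rm α⊢β γ∈Cohα γ≼¬β = γ∈Cohα (rm γ≼¬β (¬-antitone α⊢β))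

mainTheorem5 :
    {At : Set} (C : ConsequenceRelation At) →
    let open Entrenchment C in
    (_≼_ : Formula At → Formula At → Set) → IsEntrenchment _≼_ →
    (α β : Formula At) →
    -- (1)
    ((α ⊢₁ β) → (β ⊢₁ α) →
      (Coh _≼_ α ≐ Coh _≼_ β) × (Coh _≼_ β ≐ Coh _≼_ (α ∧' β)))
    -- (2)
    × (BoundedCut _≼_ → (¬' β) ≼ (¬' α) →
      (Coh _≼_ α ⊆ Coh _≼_ (α ∧' β)) × (B _≼_ α ⊆ᶠ B _≼_ (α ∧' β)))
    -- (3)
    × (BoundedRightMonotonicity _≼_ → (¬' β) ≼ (¬' α) →
      (Coh _≼_ (α ∧' β) ⊆ Coh _≼_ α) × (B _≼_ (α ∧' β) ⊆ᶠ B _≼_ α))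
    -- (4)
    × (BoundedCut _≼_ → BoundedRightMonotonicity _≼_ → (¬' β) ≼ (¬' α) →
      (Coh _≼_ (α ∧' β) ≐ Coh _≼_ α) × (B _≼_ α ≐ᶠ B _≼_ (α ∧' β)))
    -- (5)
    × (RightMonotonicity _≼_ → α ⊢₁ β →
      (Coh _≼_ α ⊆ Coh _≼_ β) × (B _≼_ α ⊆ᶠ B _≼_ β))
mainTheorem5 C _≼_ E α β =
    (λ α⊢β β⊢α → Coh-cong E α⊢β β⊢α , Coh-cong E (∧-introʳ β⊢α) ∧-elimʳ)
  , (λ bc ¬β≼¬α → let ⊆∧ = Coh⊆Coh-∧ E bc ¬β≼¬α in ⊆∧ , B-mono ⊆∧)
  , (λ brm ¬β≼¬α → let ∧⊆ = Coh-∧⊆Coh E brm ¬β≼¬α in ∧⊆ , B-mono ∧⊆)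
  , (λ bc brm ¬β≼¬α →
       let ⊆∧ = Coh⊆Coh-∧ E bc ¬β≼¬α
           ∧⊆ = Coh-∧⊆Coh E brm ¬β≼¬α
       in (∧⊆ , ⊆∧) , (B-mono ⊆∧ , B-mono ∧⊆))
  , (λ rm α⊢β → let ⊆ = Coh-mono rm α⊢β in ⊆ , B-mono ⊆)
  where
  open Classical C
  open Coherence C _≼_
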